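{- Let $n$ be a positive integer with $n\ge 8$ and $i\in\{1,2\}$. Then $r(T_n^i,T_n')=r(T_n^i,T_n^*)=2n-5$.
   Context: All graphs are finite and simple. For graphs $G_1,G_2$, the Ramsey number $r(G_1,G_2)$ is the smallest positive integer $N$ such that for every graph $G$ on $N$ vertices, either $G$ contains a subgraph isomorphic to $G_1$ or the complement $\overline G$ contains a subgraph isomorphic to $G_2$. $T_n^1$ is the tree with vertex set $\{v_0,\ldots,v_{n-1}\}$ and edge set $\{v_0v_1,\ldots,v_0v_{n-3},v_{n-4}v_{n-2},v_{n-3}v_{n-1}\}$; $T_n^2$ is the tree with the same vertex set and edge set $\{v_0v_1,\ldots,v_0v_{n-3},v_{n-3}v_{n-2},v_{n-3}v_{n-1}\}$. $T_n'$ is the unique (up to isomorphism) tree on $n$ vertices with maximum degree $n-2$. $T_n^*$ is the tree with vertex set $\{v_0,\ldots,v_{n-1}\}$ and edge set $\{v_0v_1,\ldots,v_0v_{n-3},v_{n-3}v_{n-2},v_{n-2}v_{n-1}\}$. -}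

module Defs where

open import Data.Nat using (ℕ; _+_; _*_; _∸_; _≤_; _<_)
open import Data.Fin using (Fin; toℕ; zero; suc)
open import Data.Empty using (⊥-elim)
open import Data.Sum using (_⊎_)
open import Data.Bool using (Bool; true; false; not; if_then_else_)
open import Data.Product using (Σ; _×_; _,_)
open import Relation.Binary.PropositionalEquality using (_≡_; _≢_; refl; sym)
open import Relation.Nullary using (¬_; yes; no)
open import Function.Definitions using (Injective)
import Data.Fin.Properties as FinP

record Graph (N : ℕ) : Set where
  field
    adj   : Fin N → Fin N → Bool
    adj-sym : ∀ u v → adj u v ≡ adj v u
    adj-irr : ∀ u → adj u u ≡ false
open Graph public

complAdj : ∀ {N} → Graph N → Fin N → Fin N → Bool
complAdj G u v with u FinP.≟ v
... | yes _ = false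
... | no  _ = not (adj G u v)

complSym : ∀ {N} (G : Graph N) u v → complAdj G u v ≡ complAdj G v u
complSym G u v with u FinP.≟ v | v FinP.≟ u
... | yes _ | yes _ = refl
... | yes p | no q = ⊥-elim (q (sym p))
... | no p | yes q = ⊥-elim (p (sym q))
... | no _ | no _ rewrite adj-sym G u v = refl

complIrr : ∀ {N} (G : Graph N) u → complAdj G u u ≡ false
complIrr G u with u FinP.≟ u
... | yes _ = refl
... | no p = ⊥-elim (p refl)

complement : ∀ {N} → Graph N → Graph N
complement G = record { adj = complAdj G ; adj-sym = complSym G ; adj-irr = complIrr G }

-- A small (pattern) graph on vertices v₀,…,v_{n-1} (identified with
-- Fin n via toℕ), given by an edge relation E on indices.
Contains : ∀ {N} (n : ℕ) (E : ℕ → ℕ → Set) → Graph N → Set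
Contains {N} n E G =
  Σ (Fin n → Fin N) λ f →
    Injective _≡_ _≡_ f × (∀ u v → E (toℕ u) (toℕ v) → adj G (f u) (f v) ≡ true)

Arrows : (N : ℕ) (n₁ : ℕ) (E₁ : ℕ → ℕ → Set) (n₂ : ℕ) (E₂ : ℕ → ℕ → Set) → Set
Arrows N n₁ E₁ n₂ E₂ =
  (G : Graph N) → Contains n₁ E₁ G ⊎ Contains n₂ E₂ (complement G)

RamseyIs : (n₁ : ℕ) (E₁ : ℕ → ℕ → Set) (n₂ : ℕ) (E₂ : ℕ → ℕ → Set) (R : ℕ) → Set
RamseyIs n₁ E₁ n₂ E₂ R =
  1 ≤ R × Arrows R n₁ E₁ n₂ E₂ × (∀ M → 1 ≤ M → M < R → ¬ Arrows M n₁ E₁ n₂ E₂)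

data T1Edge (n : ℕ) : ℕ → ℕ → Set where
  spoke : ∀ k → 1 ≤ k → k ≤ n ∸ 3 → T1Edge n 0 k
  e₁    : T1Edge n (n ∸ 4) (n ∸ 2)
  e₂    : T1Edge n (n ∸ 3) (n ∸ 1)

data T2Edge (n : ℕ) : ℕ → ℕ → Set where
  spoke : ∀ k → 1 ≤ k → k ≤ n ∸ 3 → T2Edge n 0 k
  e₁    : T2Edge n (n ∸ 3) (n ∸ 2)
  e₂    : T2Edge n (n ∸ 3) (n ∸ 1)

data T'Edge (n : ℕ) : ℕ → ℕ → Set where
  spoke : ∀ k → 1 ≤ k → k ≤ n ∸ 2 → T'Edge n 0 k
  e₁    : T'Edge n (n ∸ 2) (n ∸ 1)

data T*Edge (n : ℕ) : ℕ → ℕ → Set where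
  spoke : ∀ k → 1 ≤ k → k ≤ n ∸ 3 → T*Edge n 0 k
  e₁    : T*Edge n (n ∸ 3) (n ∸ 2)
  e₂    : T*Edge n (n ∸ 2) (n ∸ 1)

-- T_n^i for i ∈ {1,2} (i = zero ↦ 1, i = suc zero ↦ 2).
TiEdge : Fin 2 → ℕ → ℕ → ℕ → Set
TiEdge zero n = T1Edge n
TiEdge (suc zero) n = T2Edge n

module Submission where

-- Two disjoint cliques of at most n − 3 vertices each contain no
-- T_n^i: the centre v₀ and its n − 3 spokes would lie in one clique.  Their
-- complement is complete bipartite, and both T_n' and T_n^* have n − 2
-- vertices at odd distance from v₀, which would lie in one part.
--
-- In a graph G on 2n − 5 vertices, deg v + degᶜ v = 2n − 6.
-- We split on the degrees:  (A) some degree is ≥ n − 1;  (B) all degrees are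
-- ≤ n − 2 and some is ≤ n − 4;  (C) all degrees are n − 3 or n − 2, and some
-- is n − 2;  (D) G is (n − 3)-regular.  Case (A) yields T_n^i in G or both
-- T_n' and T_n^* in Gᶜ, case (B) both in Gᶜ, cases (C) and (D) both T_n^1 and
-- T_n^2 in G.  Every copy is a "broom": a centre with many spokes plus a few
-- named vertices, the spokes being supplied by a pigeonhole count.

open import Defs
open import Level using (0ℓ)
open import Data.Nat using (ℕ; zero; suc; _+_; _*_; _∸_; _≤_; _<_; z≤n; s≤s; _≤?_)
open import Data.Nat.Properties using
  (≤-refl; ≤-reflexive; ≤-trans; ≤-antisym; ≤-pred; <⇒≤; ≰⇒>; <⇒≱; 1+n≰n; n≤1+n; m≤n⇒m≤1+n;
   m≤m+n; m≤n+m; suc-injective; +-comm; +-suc; +-identityʳ; +-monoˡ-≤; +-cancelˡ-≤;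
   m≤n⇒m⊓n≡m; m+[n∸m]≡n; module ≤-Reasoning)
open import Data.Nat.Solver using (module +-*-Solver)
open import Data.Fin using (Fin; zero; suc; toℕ; fromℕ<; inject≤; splitAt; join)
open import Data.Fin.Properties using
  (_≟_; any?; toℕ-injective; toℕ<n; toℕ-fromℕ<; fromℕ<-injective; inject≤-injective; join-splitAt; injective⇒≤)
open import Data.Bool using (Bool; true; false; not; _xor_)
import Data.Bool.Properties as Bool
open import Data.List using (List; []; _∷_; _++_; length; filter; take; allFin)
open import Data.List.Properties using (filter-notAll; length-take; length-++; length-tabulate)
open import Data.List.Membership.Propositional using (_∈_; _∉_; find; lose)
open import Data.List.Membership.Propositional.Properties using (∈-filter⁺; ∈-filter⁻; ∈-allFin; ∈-++⁺ˡ; ∈-++⁺ʳ)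
import Data.List.Membership.DecPropositional as DecMembership
open import Data.List.Relation.Unary.All as All using (All; []; _∷_)
import Data.List.Relation.Unary.All.Properties as AllP
open import Data.List.Relation.Unary.Any as Any using (here; there)
open import Data.List.Relation.Unary.Unique.Propositional using (Unique; []; _∷_)
import Data.List.Relation.Unary.Unique.Propositional.Properties as UniqueP
import Data.List.Relation.Unary.AllPairs.Properties as AllPairsP
open import Data.Product using (∃-syntax; _×_; _,_; proj₁; proj₂)
open import Data.Sum using (_⊎_; inj₁; inj₂; [_,_]; reduce; map₂)
open import Data.Empty using (⊥; ⊥-elim)
open import Function using (_∘_)
open import Function.Definitions using (Injective)
open import Relation.Nullary using (¬_; ¬?; yes; no; Dec; _×-dec_)
import Relation.Nullary.Decidable as Dec
open import Relation.Unary using (Pred; Decidable)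
open import Relation.Unary.Properties using (∁?)
open import Relation.Binary.PropositionalEquality using
  (_≡_; _≢_; refl; sym; trans; cong; subst; subst₂; ≢-sym; module ≡-Reasoning)

module _ {A : Set} where

  filter-split : {P : Pred A 0ℓ} (P? : Decidable P) (xs : List A) →
    length (filter P? xs) + length (filter (∁? P?) xs) ≡ length xs
  filter-split P? [] = refl
  filter-split P? (x ∷ xs) with P? x
  ... | yes _ = cong suc (filter-split P? xs)
  ... | no _  = trans (+-suc _ _) (cong suc (filter-split P? xs))

  ∃∈? : {P : Pred A 0ℓ} → Decidable P → (xs : List A) → Dec (∃[ x ] x ∈ xs × P x)
  ∃∈? P? xs = Dec.map′ find (λ (x , x∈ , px) → lose x∈ px) (Any.any? P? xs)

module _ {A : Set} (_≟_ : (x y : A) → Dec (x ≡ y)) where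

  open DecMembership _≟_ using (_∈?_)

  pigeonhole : {xs ys : List A} → Unique xs → All (_∈ ys) xs → length xs ≤ length ys
  pigeonhole {[]} _ _ = z≤n
  pigeonhole {x ∷ xs} {ys} (x∉xs ∷ xs!) (x∈ys ∷ xs⊆ys) =
    ≤-trans (s≤s (pigeonhole xs! xs⊆ys-x)) shorter
    where
    others : List A
    others = filter (λ y → ¬? (y ≟ x)) ys
    xs⊆ys-x : All (_∈ others) xs
    xs⊆ys-x = All.zipWith (λ (y∈ys , x≢y) → ∈-filter⁺ _ y∈ys (λ y≡x → x≢y (sym y≡x))) (xs⊆ys , x∉xs)
    shorter : length others < length ys
    shorter = filter-notAll _ ys (Any.map (λ x≡y x≢y → x≢y (sym x≡y)) x∈ys)

  choose : (L F : List A) (k : ℕ) → Unique L → length F + k ≤ length L →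
    ∃[ S ] length S ≡ k × Unique S × All (λ s → s ∈ L × s ∉ F) S
  choose L F k L! F+k≤L =
    take k outside , trans (length-take k outside) (m≤n⇒m⊓n≡m k≤outside) ,
    AllPairsP.take⁺ k (UniqueP.filter⁺ ∉F? L!) , AllP.take⁺ k (All.tabulate (∈-filter⁻ ∉F? {xs = L}))
    where
    ∉F? : (y : A) → Dec (y ∉ F)
    ∉F? = ∁? (_∈? F)
    inside outside : List A
    inside = filter (_∈? F) L
    outside = filter ∉F? L
    inside≤F : length inside ≤ length F
    inside≤F = pigeonhole (UniqueP.filter⁺ (_∈? F) L!)
                          (All.tabulate (λ m → proj₂ (∈-filter⁻ (_∈? F) {xs = L} m)))
    k≤outside : k ≤ length outside
    k≤outside = +-cancelˡ-≤ (length F) k (length outside) (begin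
      length F + k                    ≤⟨ F+k≤L ⟩
      length L                        ≡⟨ sym (filter-split (_∈? F) L) ⟩
      length inside + length outside  ≤⟨ +-monoˡ-≤ (length outside) inside≤F ⟩
      length F + length outside       ∎)
      where open ≤-Reasoning

  fresh : (L F : List A) → Unique L → length F < length L → ∃[ u ] u ∈ L × All (_≢ u) F
  fresh L F L! F<L with choose L F 1 L! (subst (_≤ length L) (+-comm 1 (length F)) F<L)
  ... | u ∷ [] , _ , _ , (u∈L , u∉F) ∷ [] = u , u∈L , All.tabulate (λ v∈F v≡u → u∉F (subst (_∈ F) v≡u v∈F))

module Neighbourhood {N : ℕ} (H : Graph N) where

  nb : Fin N → List (Fin N)
  nb v = filter (λ u → adj H v u Bool.≟ true) (allFin N)

  deg : Fin N → ℕ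
  deg v = length (nb v)

  nb-unique : ∀ v → Unique (nb v)
  nb-unique v = UniqueP.filter⁺ _ (UniqueP.allFin⁺ N)

  adj⇒nb : ∀ {v u} → adj H v u ≡ true → u ∈ nb v
  adj⇒nb {v} {u} vu = ∈-filter⁺ (λ u → adj H v u Bool.≟ true) (∈-allFin u) vu

  nb⇒adj : ∀ {v u} → u ∈ nb v → adj H v u ≡ true
  nb⇒adj {v} u∈ = proj₂ (∈-filter⁻ (λ u → adj H v u Bool.≟ true) {xs = allFin N} u∈)

  nb-irrefl : ∀ {v u} → u ∈ nb v → v ≢ u
  nb-irrefl {v} u∈ refl with trans (sym (nb⇒adj u∈)) (adj-irr H v)
  ... | ()

  nb-sym : ∀ {v u} → u ∈ nb v → v ∈ nb u
  nb-sym {v} {u} u∈ = adj⇒nb (trans (adj-sym H u v) (nb⇒adj u∈))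

module Complement {N : ℕ} (G : Graph N) where

  open Neighbourhood G public
  open Neighbourhood (complement G) public using () renaming
    (nb to nbᶜ; deg to degᶜ; nb-unique to nbᶜ-unique; nb-irrefl to nbᶜ-irrefl)
  private
    module Nᶜ = Neighbourhood (complement G)

  co-adj : ∀ {v u} → v ≢ u → adj G v u ≡ false → complAdj G v u ≡ true
  co-adj {v} {u} v≢u vu with v ≟ u
  ... | yes v≡u = ⊥-elim (v≢u v≡u)
  ... | no _ rewrite vu = refl

  co-adj⁻ : ∀ {v u} → complAdj G v u ≡ true → adj G v u ≡ false
  co-adj⁻ {v} {u} vu with v ≟ u
  co-adj⁻ {v} {u} () | yes _
  ... | no _ with adj G v u
  co-adj⁻ {v} {u} () | no _ | true
  ... | false = refl

  nb-disjoint : ∀ {v u} → u ∈ nb v → u ∉ nbᶜ v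
  nb-disjoint {v} u∈nb u∈nbᶜ with trans (sym (nb⇒adj u∈nb)) (co-adj⁻ {v} (Nᶜ.nb⇒adj {v} u∈nbᶜ))
  ... | ()

  nb-nbᶜ-distinct : ∀ {v x a} → x ∈ nb v → a ∈ nbᶜ v → x ≢ a
  nb-nbᶜ-distinct x∈ a∈ refl = nb-disjoint x∈ a∈

  nbᶜ-intro : ∀ {v u} → v ≢ u → u ∉ nb v → u ∈ nbᶜ v
  nbᶜ-intro {v} {u} v≢u u∉nb with adj G v u in vu
  ... | true = ⊥-elim (u∉nb (adj⇒nb vu))
  ... | false = Nᶜ.adj⇒nb {v} (co-adj v≢u vu)

  nb-intro : ∀ {v u} → v ≢ u → u ∉ nbᶜ v → u ∈ nb v
  nb-intro {v} {u} v≢u u∉nbᶜ with adj G v u in vu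
  ... | true = adj⇒nb vu
  ... | false = ⊥-elim (u∉nbᶜ (Nᶜ.adj⇒nb {v} (co-adj v≢u vu)))

  -- Every vertex lies in exactly one of {v}, N(v), Nᶜ(v); hence the degree sum.
  degree-sum : ∀ v → suc (deg v + degᶜ v) ≡ N
  degree-sum v = ≤-antisym
    (subst₂ _≤_ length-star length-all (pigeonhole _≟_ star-unique (All.tabulate (λ {u} _ → ∈-allFin u))))
    (subst₂ _≤_ length-all length-star (pigeonhole _≟_ (UniqueP.allFin⁺ N) (All.tabulate (λ {u} _ → covers u))))
    where
    star : List (Fin N)
    star = v ∷ nb v ++ nbᶜ v
    star-unique : Unique star
    star-unique = AllP.++⁺ (All.tabulate nb-irrefl) (All.tabulate nbᶜ-irrefl)
                ∷ UniqueP.++⁺ (nb-unique v) (nbᶜ-unique v) (λ (u∈nb , u∈nbᶜ) → nb-disjoint u∈nb u∈nbᶜ)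
    covers : ∀ u → u ∈ star
    covers u with v ≟ u | adj G v u in vu
    ... | yes refl | _ = here refl
    ... | no _ | true = there (∈-++⁺ˡ (adj⇒nb vu))
    ... | no v≢u | false = there (∈-++⁺ʳ (nb v) (Nᶜ.adj⇒nb {v} (co-adj v≢u vu)))
    length-star : length star ≡ suc (deg v + degᶜ v)
    length-star = cong suc (length-++ (nb v))
    length-all : length (allFin N) ≡ N
    length-all = length-tabulate (λ u → u)

  -- A co-neighbour b of c with deg b ≥ degᶜ c has a neighbour in common with c,
  -- since N(b) cannot fit inside Nᶜ(c) ∖ {b}.  Only the existence matters, so
  -- the proof is opaque: case analyses on its result need not unfold it.
  opaque
    common-neighbour : ∀ {c b} → b ∈ nbᶜ c → degᶜ c ≤ deg b → ∃[ a ] a ∈ nb b × a ∈ nb c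
    common-neighbour {c} {b} b∈c dc≤db
      with fresh _≟_ (nb b) (filter (λ u → ¬? (u ≟ b)) (nbᶜ c)) (nb-unique b)
             (≤-trans (filter-notAll _ (nbᶜ c) (Any.map (λ b≡u u≢b → u≢b (sym b≡u)) b∈c)) dc≤db)
    ... | a , a∈b , a∉others = a , a∈b , nb-intro c≢a a∉nbᶜ
      where
      c≢a : c ≢ a
      c≢a refl = nb-disjoint (nb-sym a∈b) b∈c
      a∉nbᶜ : a ∉ nbᶜ c
      a∉nbᶜ a∈c = All.lookup a∉others (∈-filter⁺ _ a∈c (λ a≡b → nb-irrefl a∈b (sym a≡b))) refl

-- Each tree is a "broom": a centre c
-- joined to many spokes, plus a few named vertices R carrying the remaining
-- edges.  We place the pattern vertices v₀, v₁, … along the list c ∷ S ++ R,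
-- where S are extra spokes chosen among the unused neighbours of c.
module Brooms {N : ℕ} (H : Graph N) where

  open Neighbourhood H

  -- The i-th entry of a list (d past its end).
  at : Fin N → List (Fin N) → ℕ → Fin N
  at d [] _ = d
  at d (x ∷ xs) zero = x
  at d (x ∷ xs) (suc i) = at d xs i

  at-∈ : ∀ d xs i → i < length xs → at d xs i ∈ xs
  at-∈ d (x ∷ xs) zero _ = here refl
  at-∈ d (x ∷ xs) (suc i) (s≤s i<) = there (at-∈ d xs i i<)

  at-++ : ∀ d xs ys j → at d (xs ++ ys) (j + length xs) ≡ at d ys j
  at-++ d [] ys j rewrite +-identityʳ j = refl
  at-++ d (x ∷ xs) ys j rewrite +-suc j (length xs) = at-++ d xs ys j

  at-prefix : ∀ d S P R t → t < length P + length S → at d (S ++ P ++ R) t ∈ S ++ P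
  at-prefix d [] (p ∷ P) R zero _ = here refl
  at-prefix d [] (p ∷ P) R (suc t) (s≤s t<) = there (at-prefix d [] P R t t<)
  at-prefix d (x ∷ S) P R zero _ = here refl
  at-prefix d (x ∷ S) P R (suc t) t< =
    there (at-prefix d S P R t (≤-pred (subst (suc (suc t) ≤_) (+-suc (length P) (length S)) t<)))

  at-injective : ∀ d xs i j → Unique xs → i < length xs → j < length xs → at d xs i ≡ at d xs j → i ≡ j
  at-injective d (x ∷ xs) zero zero _ _ _ _ = refl
  at-injective d (x ∷ xs) zero (suc j) (x∉ ∷ _) _ (s≤s j<) x≡ = ⊥-elim (All.lookup x∉ (at-∈ d xs j j<) x≡)
  at-injective d (x ∷ xs) (suc i) zero (x∉ ∷ _) (s≤s i<) _ ≡x = ⊥-elim (All.lookup x∉ (at-∈ d xs i i<) (sym ≡x))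
  at-injective d (x ∷ xs) (suc i) (suc j) (_ ∷ xs!) (s≤s i<) (s≤s j<) eq = cong suc (at-injective d xs i j xs! i< j< eq)

  list-copy : ∀ {n} {E : ℕ → ℕ → Set} (d : Fin N) (W : List (Fin N)) → length W ≡ n → Unique W →
    (∀ i j → E i j → adj H (at d W i) (at d W j) ≡ true) → Contains n E H
  list-copy {n} d W |W| W! edges =
    (λ i → at d W (toℕ i)) ,
    (λ {i} {j} eq → toℕ-injective (at-injective d W (toℕ i) (toℕ j) W! (bound i) (bound j) eq)) ,
    (λ i j → edges (toℕ i) (toℕ j))
    where
    bound : (i : Fin n) → toℕ i < length W
    bound i = subst (toℕ i <_) (sym |W|) (toℕ<n i)

  -- Choose s spokes of c outside F.  If F contains every vertex of R adjacent to c,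
  -- the spokes are new, so c ∷ S ++ R stays duplicate-free.
  extra-spokes : ∀ c R F s → Unique (c ∷ R) → All (λ u → u ∈ nb c → u ∈ F) R → length F + s ≤ deg c →
    ∃[ S ] length S ≡ s × Unique (c ∷ S ++ R) × All (_∈ nb c) S
  extra-spokes c R F s (c∉R ∷ R!) F-covers bound
    with choose _≟_ (nb c) F s (nb-unique c) bound
  ... | S , |S| , S! , S-spec =
    S , |S| , AllP.++⁺ (All.map (nb-irrefl ∘ proj₁) S-spec) c∉R ∷ UniqueP.++⁺ S! R! disjoint ,
    All.map proj₁ S-spec
    where
    disjoint : ∀ {u} → ¬ (u ∈ S × u ∈ R)
    disjoint (u∈S , u∈R) with All.lookup S-spec u∈S
    ... | u∈N , u∉F = u∉F (All.lookup F-covers u∈R u∈N)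

  spoke-edge : ∀ c S P R t → All (_∈ nb c) (S ++ P) → t < length P + length S →
    adj H c (at c (S ++ P ++ R) t) ≡ true
  spoke-edge c S P R t S⊆N t< = nb⇒adj (All.lookup S⊆N (at-prefix c S P R t t<))

  broom-copy : (E : ℕ → ℕ → ℕ → Set) (c : Fin N) (R F : List (Fin N)) (s : ℕ) →
    Unique (c ∷ R) → All (λ u → u ∈ nb c → u ∈ F) R → length F + s ≤ deg c →
    (∀ S → All (_∈ nb c) S → ∀ i j → E (length S) i j →
       adj H (at c (c ∷ S ++ R) i) (at c (c ∷ S ++ R) j) ≡ true) →
    Contains (suc (length R + s)) (E s) H
  broom-copy E c R F s core! F-covers bound edges with extra-spokes c R F s core! F-covers bound
  ... | S , refl , W! , S⊆N =
    list-copy c (c ∷ S ++ R) (cong suc (trans (length-++ S) (+-comm (length S) (length R)))) W! (edges S S⊆N)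

  T1-copy : ∀ {c a b x y} (F : List (Fin N)) (s : ℕ) →
    a ∈ nb c → b ∈ nb c → x ∈ nb a → y ∈ nb b →
    a ≢ b → c ≢ x → c ≢ y → a ≢ y → b ≢ x → x ≢ y →
    All (λ u → u ∈ nb c → u ∈ F) (a ∷ b ∷ x ∷ y ∷ []) → length F + s ≤ deg c →
    Contains (5 + s) (T1Edge (5 + s)) H
  T1-copy {c} {a} {b} {x} {y} F s a∈c b∈c x∈a y∈b a≢b c≢x c≢y a≢y b≢x x≢y F-covers bound =
    broom-copy (λ s → T1Edge (5 + s)) c R F s
      ((nb-irrefl a∈c ∷ nb-irrefl b∈c ∷ c≢x ∷ c≢y ∷ []) ∷ (a≢b ∷ nb-irrefl x∈a ∷ a≢y ∷ []) ∷
       (b≢x ∷ nb-irrefl y∈b ∷ []) ∷ (x≢y ∷ []) ∷ [] ∷ [])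
      F-covers bound edges
    where
    R : List (Fin N)
    R = a ∷ b ∷ x ∷ y ∷ []
    edges : ∀ S → All (_∈ nb c) S → ∀ i j → T1Edge (5 + length S) i j →
      adj H (at c (c ∷ S ++ R) i) (at c (c ∷ S ++ R) j) ≡ true
    edges S S⊆N _ _ (spoke (suc t) _ t<) = spoke-edge c S (a ∷ b ∷ []) (x ∷ y ∷ []) t (AllP.++⁺ S⊆N (a∈c ∷ b∈c ∷ [])) t<
    edges S _ _ _ e₁ rewrite at-++ c S R 0 | at-++ c S R 2 = nb⇒adj x∈a
    edges S _ _ _ e₂ rewrite at-++ c S R 1 | at-++ c S R 3 = nb⇒adj y∈b

  T2-copy : ∀ {c a x y} (F : List (Fin N)) (s : ℕ) →
    a ∈ nb c → x ∈ nb a → y ∈ nb a → c ≢ x → c ≢ y → x ≢ y →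
    All (λ u → u ∈ nb c → u ∈ F) (a ∷ x ∷ y ∷ []) → length F + s ≤ deg c →
    Contains (4 + s) (T2Edge (4 + s)) H
  T2-copy {c} {a} {x} {y} F s a∈c x∈a y∈a c≢x c≢y x≢y F-covers bound =
    broom-copy (λ s → T2Edge (4 + s)) c R F s
      ((nb-irrefl a∈c ∷ c≢x ∷ c≢y ∷ []) ∷ (nb-irrefl x∈a ∷ nb-irrefl y∈a ∷ []) ∷ (x≢y ∷ []) ∷ [] ∷ [])
      F-covers bound edges
    where
    R : List (Fin N)
    R = a ∷ x ∷ y ∷ []
    edges : ∀ S → All (_∈ nb c) S → ∀ i j → T2Edge (4 + length S) i j →
      adj H (at c (c ∷ S ++ R) i) (at c (c ∷ S ++ R) j) ≡ true
    edges S S⊆N _ _ (spoke (suc t) _ t<) = spoke-edge c S (a ∷ []) (x ∷ y ∷ []) t (AllP.++⁺ S⊆N (a∈c ∷ [])) t<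
    edges S _ _ _ e₁ rewrite at-++ c S R 0 | at-++ c S R 1 = nb⇒adj x∈a
    edges S _ _ _ e₂ rewrite at-++ c S R 0 | at-++ c S R 2 = nb⇒adj y∈a

  T*-copy : ∀ {c a x y} (F : List (Fin N)) (s : ℕ) →
    a ∈ nb c → x ∈ nb a → y ∈ nb x → c ≢ x → c ≢ y → a ≢ y →
    All (λ u → u ∈ nb c → u ∈ F) (a ∷ x ∷ y ∷ []) → length F + s ≤ deg c →
    Contains (4 + s) (T*Edge (4 + s)) H
  T*-copy {c} {a} {x} {y} F s a∈c x∈a y∈x c≢x c≢y a≢y F-covers bound =
    broom-copy (λ s → T*Edge (4 + s)) c R F s
      ((nb-irrefl a∈c ∷ c≢x ∷ c≢y ∷ []) ∷ (nb-irrefl x∈a ∷ a≢y ∷ []) ∷ (nb-irrefl y∈x ∷ []) ∷ [] ∷ [])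
      F-covers bound edges
    where
    R : List (Fin N)
    R = a ∷ x ∷ y ∷ []
    edges : ∀ S → All (_∈ nb c) S → ∀ i j → T*Edge (4 + length S) i j →
      adj H (at c (c ∷ S ++ R) i) (at c (c ∷ S ++ R) j) ≡ true
    edges S S⊆N _ _ (spoke (suc t) _ t<) = spoke-edge c S (a ∷ []) (x ∷ y ∷ []) t (AllP.++⁺ S⊆N (a∈c ∷ [])) t<
    edges S _ _ _ e₁ rewrite at-++ c S R 0 | at-++ c S R 1 = nb⇒adj x∈a
    edges S _ _ _ e₂ rewrite at-++ c S R 1 | at-++ c S R 2 = nb⇒adj y∈x

  T'-copy : ∀ {c a x} (F : List (Fin N)) (s : ℕ) →
    a ∈ nb c → x ∈ nb a → c ≢ x →
    All (λ u → u ∈ nb c → u ∈ F) (a ∷ x ∷ []) → length F + s ≤ deg c →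
    Contains (3 + s) (T'Edge (3 + s)) H
  T'-copy {c} {a} {x} F s a∈c x∈a c≢x F-covers bound =
    broom-copy (λ s → T'Edge (3 + s)) c R F s
      ((nb-irrefl a∈c ∷ c≢x ∷ []) ∷ (nb-irrefl x∈a ∷ []) ∷ [] ∷ [])
      F-covers bound edges
    where
    R : List (Fin N)
    R = a ∷ x ∷ []
    edges : ∀ S → All (_∈ nb c) S → ∀ i j → T'Edge (3 + length S) i j →
      adj H (at c (c ∷ S ++ R) i) (at c (c ∷ S ++ R) j) ≡ true
    edges S S⊆N _ _ (spoke (suc t) _ t<) = spoke-edge c S (a ∷ []) (x ∷ []) t (AllP.++⁺ S⊆N (a∈c ∷ [])) t<
    edges S _ _ _ e₁ rewrite at-++ c S R 0 | at-++ c S R 1 = nb⇒adj x∈a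

-- Two disjoint cliques on M ≤ 2m vertices, each of size at most m.  A copy of
-- any of the four trees in it, or in its complement (a complete bipartite
-- graph), would put m + 1 of its vertices on one side.
module TwoCliques (m : ℕ) {M : ℕ} (M≤2m : M ≤ m + m) where

  place : Fin M → Fin m ⊎ Fin m
  place v = splitAt m (inject≤ v M≤2m)

  place-injective : ∀ {u v} → place u ≡ place v → u ≡ v
  place-injective {u} {v} eq = inject≤-injective M≤2m M≤2m u v (begin
    inject≤ u M≤2m          ≡⟨ sym (join-splitAt m m _) ⟩
    join m m (place u)      ≡⟨ cong (join m m) eq ⟩
    join m m (place v)      ≡⟨ join-splitAt m m _ ⟩
    inject≤ v M≤2m          ∎)
    where open ≡-Reasoning

  isLeft : Fin m ⊎ Fin m → Bool
  isLeft = [ (λ _ → true) , (λ _ → false) ]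

  side : Fin M → Bool
  side = isLeft ∘ place

  same-half : ∀ x y → isLeft x ≡ isLeft y → reduce x ≡ reduce y → x ≡ y
  same-half (inj₁ _) (inj₁ _) _ eq = cong inj₁ eq
  same-half (inj₂ _) (inj₂ _) _ eq = cong inj₂ eq
  same-half (inj₁ _) (inj₂ _) ()
  same-half (inj₂ _) (inj₁ _) ()

  side-capacity : (g : Fin (suc m) → Fin M) → Injective _≡_ _≡_ g → (b : Bool) → (∀ j → side (g j) ≡ b) → ⊥
  side-capacity g g-inj b g-side = 1+n≰n (injective⇒≤ {f = reduce ∘ place ∘ g} reduce-inj)
    where
    reduce-inj : ∀ {i j} → reduce (place (g i)) ≡ reduce (place (g j)) → i ≡ j
    reduce-inj {i} {j} eq = g-inj (place-injective (same-half _ _ (trans (g-side i) (sym (g-side j))) eq))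

  sameSide : Fin M → Fin M → Bool
  sameSide u v with u ≟ v
  ... | yes _ = false
  ... | no _ = not (side u xor side v)

  sameSide-sym : ∀ u v → sameSide u v ≡ sameSide v u
  sameSide-sym u v with u ≟ v | v ≟ u
  ... | yes _ | yes _ = refl
  ... | yes u≡v | no v≢u = ⊥-elim (v≢u (sym u≡v))
  ... | no u≢v | yes v≡u = ⊥-elim (u≢v (sym v≡u))
  ... | no _ | no _ = cong not (Bool.xor-comm (side u) (side v))

  sameSide-irrefl : ∀ u → sameSide u u ≡ false
  sameSide-irrefl u with u ≟ u
  ... | yes _ = refl
  ... | no u≢u = ⊥-elim (u≢u refl)

  twoCliques : Graph M
  twoCliques = record { adj = sameSide ; adj-sym = sameSide-sym ; adj-irr = sameSide-irrefl }

  xnor-true : ∀ a b → not (a xor b) ≡ true → a ≡ b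
  xnor-true false false _ = refl
  xnor-true true true _ = refl
  xnor-true false true ()
  xnor-true true false ()

  xnor-false : ∀ a b → not (not (a xor b)) ≡ true → b ≡ not a
  xnor-false false true _ = refl
  xnor-false true false _ = refl
  xnor-false false false ()
  xnor-false true true ()

  clique-edge : ∀ {u v} → sameSide u v ≡ true → side u ≡ side v
  clique-edge {u} {v} uv with u ≟ v
  clique-edge {u} {v} () | yes _
  ... | no _ = xnor-true (side u) (side v) uv

  co-edge : ∀ {u v} → complAdj twoCliques u v ≡ true → side v ≡ not (side u)
  co-edge {u} {v} uv with u ≟ v
  co-edge {u} {v} () | yes _
  ... | no u≢v with u ≟ v
  ... | yes u≡v = ⊥-elim (u≢v u≡v)
  ... | no _ = xnor-false (side u) (side v) uv

  -- The pattern vertex e together with the spoke ends 1, …, m; these are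
  -- m + 1 distinct pattern vertices when e is not itself among 1, …, m.
  index : ℕ → Fin (suc m) → ℕ
  index e zero = e
  index e (suc j) = suc (toℕ j)

  index-injective : ∀ e → e ≡ 0 ⊎ m < e → ∀ i j → index e i ≡ index e j → i ≡ j
  index-injective e _ zero zero _ = refl
  index-injective e _ (suc i) (suc j) eq = cong suc (toℕ-injective (suc-injective eq))
  index-injective .0 (inj₁ refl) zero (suc j) ()
  index-injective .0 (inj₁ refl) (suc i) zero ()
  index-injective e (inj₂ m<e) zero (suc j) eq = ⊥-elim (<⇒≱ m<e (subst (_≤ m) (sym eq) (toℕ<n j)))
  index-injective e (inj₂ m<e) (suc i) zero eq = ⊥-elim (<⇒≱ m<e (subst (_≤ m) eq (toℕ<n i)))

  module Copy {H : Graph M} {E : ℕ → ℕ → Set} (copy : Contains (3 + m) E H) where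

    f : Fin (3 + m) → Fin M
    f = proj₁ copy

    vertex : ∀ t → t < 3 + m → Fin M
    vertex t t< = f (fromℕ< t<)

    edge : ∀ {t t'} (t< : t < 3 + m) (t'< : t' < 3 + m) → E t t' → adj H (vertex t t<) (vertex t' t'<) ≡ true
    edge t< t'< e = proj₂ (proj₂ copy) _ _ (subst₂ E (sym (toℕ-fromℕ< t<)) (sym (toℕ-fromℕ< t'<)) e)

    spoke< : ∀ (j : Fin m) → suc (toℕ j) < 3 + m
    spoke< j = s≤s (≤-trans (toℕ<n j) (m≤n+m m 2))

    m+1-on-one-side : ∀ e (e< : e < 3 + m) → e ≡ 0 ⊎ m < e → (b : Bool) →
      side (vertex e e<) ≡ b → (∀ (j : Fin m) → side (vertex (suc (toℕ j)) (spoke< j)) ≡ b) → ⊥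
    m+1-on-one-side e e< e-outside b e-side spokes-side =
      side-capacity (λ j → vertex (index e j) (index< j)) g-inj b g-side
      where
      index< : ∀ j → index e j < 3 + m
      index< zero = e<
      index< (suc j) = spoke< j
      g-side : ∀ j → side (vertex (index e j) (index< j)) ≡ b
      g-side zero = e-side
      g-side (suc j) = spokes-side j
      g-inj : Injective _≡_ _≡_ (λ j → vertex (index e j) (index< j))
      g-inj {i} {j} eq = index-injective e e-outside i j (fromℕ<-injective _ _ (index< i) (index< j) (proj₁ (proj₂ copy) eq))

  no-broom : ∀ {E} → (∀ t → 1 ≤ t → t ≤ m → E 0 t) → ¬ Contains (3 + m) E twoCliques
  no-broom {E} spokes copy =
    m+1-on-one-side 0 (s≤s z≤n) (inj₁ refl) (side (vertex 0 (s≤s z≤n))) refl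
      (λ j → sym (clique-edge (edge (s≤s z≤n) (spoke< j) (spokes (suc (toℕ j)) (s≤s z≤n) (toℕ<n j)))))
    where open Copy {twoCliques} {E} copy

  module CoCopy {E : ℕ → ℕ → Set} (copy : Contains (3 + m) E (complement twoCliques))
                (spokes : ∀ t → 1 ≤ t → t ≤ m → E 0 t) where
    open Copy {complement twoCliques} {E} copy public

    opposite : ∀ {t} (t< : t < 3 + m) → E 0 t → side (vertex t t<) ≡ not (side (vertex 0 (s≤s z≤n)))
    opposite t< e = co-edge (edge (s≤s z≤n) t< e)

    spokes-opposite : ∀ (j : Fin m) → side (vertex (suc (toℕ j)) (spoke< j)) ≡ not (side (vertex 0 (s≤s z≤n)))
    spokes-opposite j = opposite (spoke< j) (spokes (suc (toℕ j)) (s≤s z≤n) (toℕ<n j))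

  -- T_n' has m + 1 spokes, all opposite to its centre.
  no-T' : ¬ Contains (3 + m) (T'Edge (3 + m)) (complement twoCliques)
  no-T' copy = m+1-on-one-side (suc m) m+1< (inj₂ ≤-refl) _ (opposite m+1< (spoke (suc m) (s≤s z≤n) ≤-refl))
                 spokes-opposite
    where
    open CoCopy {T'Edge (3 + m)} copy (λ t 1≤t t≤m → spoke t 1≤t (m≤n⇒m≤1+n t≤m))
    m+1< : suc m < 3 + m
    m+1< = s≤s (n≤1+n (suc m))

  -- In T_n^*, the end v_{m+2} of the path v_m v_{m+1} v_{m+2} is opposite to the centre too.
  no-T* : 1 ≤ m → ¬ Contains (3 + m) (T*Edge (3 + m)) (complement twoCliques)
  no-T* 1≤m copy = m+1-on-one-side (2 + m) ≤-refl (inj₂ (n≤1+n (suc m))) _ path-end-opposite spokes-opposite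
    where
    open CoCopy {T*Edge (3 + m)} copy spoke
    m< : m < 3 + m
    m< = m≤n+m (suc m) 2
    m+1< : suc m < 3 + m
    m+1< = s≤s (n≤1+n (suc m))
    path-end-opposite : side (vertex (2 + m) ≤-refl) ≡ not (side (vertex 0 (s≤s z≤n)))
    path-end-opposite = begin
      side (vertex (2 + m) ≤-refl)      ≡⟨ co-edge (edge m+1< ≤-refl e₂) ⟩
      not (side (vertex (suc m) m+1<))  ≡⟨ cong not (co-edge (edge m< m+1< e₁)) ⟩
      not (not (side (vertex m m<)))    ≡⟨ Bool.not-involutive _ ⟩
      side (vertex m m<)                ≡⟨ opposite m< (spoke m 1≤m ≤-refl) ⟩
      not (side (vertex 0 (s≤s z≤n)))   ∎
      where open ≡-Reasoning

  -- T_n^1 and T_n^2 both join v₀ to v₁, …, v_m.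
  no-Ti : ∀ i → ¬ Contains (3 + m) (TiEdge i (3 + m)) twoCliques
  no-Ti zero = no-broom {T1Edge (3 + m)} spoke
  no-Ti (suc zero) = no-broom {T2Edge (3 + m)} spoke

-- Below 2(n − 3) + 1 vertices, the two cliques defeat both arrows (n = m + 3).
lower-bound : ∀ m {M} → 1 ≤ m → M ≤ m + m → ∀ i →
  ¬ Arrows M (3 + m) (TiEdge i (3 + m)) (3 + m) (T'Edge (3 + m)) ×
  ¬ Arrows M (3 + m) (TiEdge i (3 + m)) (3 + m) (T*Edge (3 + m))
lower-bound m 1≤m M≤2m i =
  (λ arrows → [ no-Ti i , no-T' ] (arrows twoCliques)) ,
  (λ arrows → [ no-Ti i , no-T* 1≤m ] (arrows twoCliques))
  where open TwoCliques m M≤2m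

sum-bound-≥ : ∀ {x y p q} → x + y ≡ p + q → x ≤ p → q ≤ y
sum-bound-≥ {x} {y} {p} {q} eq x≤p = +-cancelˡ-≤ p q y (subst (_≤ p + y) eq (+-monoˡ-≤ y x≤p))

sum-bound-≤ : ∀ {x y p q} → x + y ≡ p + q → p ≤ x → y ≤ q
sum-bound-≤ {x} {y} {p} {q} eq p≤x = +-cancelˡ-≤ p y q (subst (p + y ≤_) eq (+-monoˡ-≤ y p≤x))

shuffle : ∀ a b k → (a + k) + (b + k) ≡ (a + b) + (k + k)
shuffle = solve 3 (λ a b k → (a :+ k) :+ (b :+ k) := (a :+ b) :+ (k :+ k)) refl
  where open +-*-Solver

covers-itself : ∀ {N} (X : List (Fin N)) (R : List (Fin N)) → All (λ u → u ∈ X → u ∈ R) R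
covers-itself X R = All.tabulate (λ u∈R _ → u∈R)

module UpperBound (k : ℕ) {N : ℕ} (G : Graph N) (N≡ : N ≡ suc ((5 + k) + (5 + k))) where

  open Complement G
  open DecMembership (_≟_ {N}) using (_∈?_)
  open Brooms G using (T1-copy; T2-copy)
  open Brooms (complement G) using (T'-copy; T*-copy)

  n : ℕ
  n = 8 + k

  T1⊆G T2⊆G T'⊆Gᶜ T*⊆Gᶜ : Set
  T1⊆G = Contains n (T1Edge n) G
  T2⊆G = Contains n (T2Edge n) G
  T'⊆Gᶜ = Contains n (T'Edge n) (complement G)
  T*⊆Gᶜ = Contains n (T*Edge n) (complement G)

  deg-sum : ∀ v → deg v + degᶜ v ≡ (5 + k) + (5 + k)
  deg-sum v = suc-injective (trans (degree-sum v) N≡)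

  split : ∀ a b → a + b ≡ 10 → (a + k) + (b + k) ≡ (5 + k) + (5 + k)
  split a b a+b≡10 = trans (shuffle a b k) (trans (cong (_+ (k + k)) a+b≡10) (sym (shuffle 5 5 k)))

  degᶜ-≥ : ∀ {v} a b → a + b ≡ 10 → deg v ≤ a + k → b + k ≤ degᶜ v
  degᶜ-≥ {v} a b ab = sum-bound-≥ (trans (deg-sum v) (sym (split a b ab)))

  degᶜ-≤ : ∀ {v} a b → a + b ≡ 10 → a + k ≤ deg v → degᶜ v ≤ b + k
  degᶜ-≤ {v} a b ab = sum-bound-≤ (trans (deg-sum v) (sym (split a b ab)))

  deg-≥ : ∀ {v} a b → a + b ≡ 10 → degᶜ v ≤ a + k → b + k ≤ deg v
  deg-≥ {v} a b ab = sum-bound-≥ (trans (+-comm (degᶜ v) (deg v)) (trans (deg-sum v) (sym (split a b ab))))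

  low⇒co-high : ∀ {v} → deg v ≤ 3 → 7 + k ≤ degᶜ v
  low⇒co-high d≤3 = degᶜ-≥ 3 7 refl (≤-trans d≤3 (m≤m+n 3 k))

  ∉-of : ∀ {u} {F : List (Fin N)} → All (_≢ u) F → u ∉ F
  ∉-of F≢u u∈F = All.lookup F≢u u∈F refl

  -- Case A: a vertex of degree at least n − 1.

  -- Six vertices of degree at most 3 yield T_n' and T_n^* in the complement:
  -- centred at a, with a spoke a' ∉ N(a), a path a' x y and x chosen among them.
  low-degree-six : ∀ S → Unique S → 6 ≤ length S → All (λ v → deg v ≤ 3) S → T'⊆Gᶜ × T*⊆Gᶜ
  low-degree-six (a ∷ S) (a∉S ∷ S!) (s≤s 5≤S) (da ∷ low)
    with fresh _≟_ S (nb a) S! (≤-trans (s≤s da) (≤-trans (n≤1+n 4) 5≤S))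
  ... | a' , a'∈S , Na≢a'
    with fresh _≟_ S (a' ∷ nb a') S! (≤-trans (s≤s (s≤s (All.lookup low a'∈S))) 5≤S)
  ... | x , x∈S , a'≢x ∷ Na'≢x
    with fresh _≟_ (nbᶜ x) (a ∷ a' ∷ []) (nbᶜ-unique x) (≤-trans (s≤s (s≤s (s≤s z≤n))) (low⇒co-high (All.lookup low x∈S)))
  ... | y , y∈x , a≢y ∷ a'≢y ∷ [] =
    T'-copy (a' ∷ x ∷ []) (5 + k) a'∈a x∈a' (All.lookup a∉S x∈S) (covers-itself _ _) (low⇒co-high da) ,
    T*-copy (a' ∷ x ∷ y ∷ []) (4 + k) a'∈a x∈a' y∈x (All.lookup a∉S x∈S) a≢y a'≢y (covers-itself _ _) (low⇒co-high da)
    where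
    a'∈a : a' ∈ nbᶜ a
    a'∈a = nbᶜ-intro (All.lookup a∉S a'∈S) (∉-of Na≢a')
    x∈a' : x ∈ nbᶜ a'
    x∈a' = nbᶜ-intro a'≢x (∉-of Na'≢x)

  -- A neighbour a of degree ≥ 3 of a vertex c of degree ≥ n − 1 gives T_n^2:
  -- two further neighbours x, y of a hang off the spoke a.
  T2-at-rich-spoke : ∀ {c a} → 7 + k ≤ deg c → a ∈ nb c → 3 ≤ deg a → T2⊆G
  T2-at-rich-spoke {c} {a} dc a∈c da
    with fresh _≟_ (nb a) (c ∷ []) (nb-unique a) (≤-trans (s≤s (s≤s z≤n)) da)
  ... | x , x∈a , c≢x ∷ []
    with fresh _≟_ (nb a) (c ∷ x ∷ []) (nb-unique a) da
  ... | y , y∈a , c≢y ∷ x≢y ∷ [] =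
    T2-copy (a ∷ x ∷ y ∷ []) (4 + k) a∈c x∈a y∈a c≢x c≢y x≢y (covers-itself _ _) dc

  T1-at-rich-spokes : ∀ {c a b} → 7 + k ≤ deg c → a ∈ nb c → b ∈ nb c → a ≢ b → 3 ≤ deg a → 4 ≤ deg b → T1⊆G
  T1-at-rich-spokes {c} {a} {b} dc a∈c b∈c a≢b da db
    with fresh _≟_ (nb a) (c ∷ b ∷ []) (nb-unique a) da
  ... | x , x∈a , c≢x ∷ b≢x ∷ []
    with fresh _≟_ (nb b) (c ∷ a ∷ x ∷ []) (nb-unique b) db
  ... | y , y∈b , c≢y ∷ a≢y ∷ x≢y ∷ [] =
    T1-copy (a ∷ b ∷ x ∷ y ∷ []) (3 + k) a∈c b∈c x∈a y∈b a≢b c≢x c≢y a≢y b≢x x≢y (covers-itself _ _) dc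

  -- Case A for i = 2: either a neighbour of c has degree ≥ 3, or all of N(c) are
  -- six or more vertices of degree ≤ 2.
  high-vertex-T2 : ∀ c → 7 + k ≤ deg c → T2⊆G ⊎ (T'⊆Gᶜ × T*⊆Gᶜ)
  high-vertex-T2 c dc with ∃∈? (λ a → 3 ≤? deg a) (nb c)
  ... | yes (a , a∈c , da) = inj₁ (T2-at-rich-spoke dc a∈c da)
  ... | no ∄ = inj₂ (low-degree-six (nb c) (nb-unique c) (≤-trans (m≤m+n 6 (suc k)) dc)
                      (All.tabulate (λ a∈c → <⇒≤ (≰⇒> (λ da → ∄ (_ , a∈c , da))))))

  -- Case A for i = 1: either N(c) has a vertex b of degree ≥ 4 and another a of
  -- degree ≥ 3, or six vertices of N(c) have degree ≤ 3.
  high-vertex-T1 : ∀ c → 7 + k ≤ deg c → T1⊆G ⊎ (T'⊆Gᶜ × T*⊆Gᶜ)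
  high-vertex-T1 c dc with ∃∈? (λ b → 4 ≤? deg b) (nb c)
  ... | no ∄ = inj₂ (low-degree-six (nb c) (nb-unique c) (≤-trans (m≤m+n 6 (suc k)) dc)
                      (All.tabulate (λ b∈c → ≤-pred (≰⇒> (λ db → ∄ (_ , b∈c , db))))))
  ... | yes (b , b∈c , db) with ∃∈? (λ a → ¬? (a ≟ b) ×-dec (3 ≤? deg a)) (nb c)
  ...   | yes (a , a∈c , a≢b , da) = inj₁ (T1-at-rich-spokes dc a∈c b∈c a≢b da db)
  ...   | no ∄ with choose _≟_ (nb c) (b ∷ []) 6 (nb-unique c) (≤-trans (m≤m+n 7 k) dc)
  ...     | S , |S| , S! , S-spec = inj₂ (low-degree-six S S! (≤-reflexive (sym |S|)) (All.map low S-spec))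
    where
    low : ∀ {a} → a ∈ nb c × a ∉ b ∷ [] → deg a ≤ 3
    low (a∈c , a∉b) = <⇒≤ (≰⇒> (λ da → ∄ (_ , a∈c , (λ a≡b → a∉b (here a≡b)) , da)))

  high-vertex : ∀ c → 7 + k ≤ deg c → ∀ i → Contains n (TiEdge i n) G ⊎ (T'⊆Gᶜ × T*⊆Gᶜ)
  high-vertex c dc zero = high-vertex-T1 c dc
  high-vertex c dc (suc zero) = high-vertex-T2 c dc

  -- Case B: all degrees are ≤ n − 2 and deg c ≤ n − 4.  Then every co-degree
  -- is ≥ n − 4 and degᶜ c ≥ n − 2.
  module LowVertex (all≤ : ∀ v → deg v ≤ 6 + k) {c : Fin N} (dc : deg c ≤ 4 + k) where

    co≥ : ∀ v → 4 + k ≤ degᶜ v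
    co≥ v = degᶜ-≥ 6 4 refl (all≤ v)

    dcᶜ : 6 + k ≤ degᶜ c
    dcᶜ = degᶜ-≥ 4 6 refl dc

    -- If degᶜ c ≥ n − 1, follow a co-path c a x y.
    co-high : 7 + k ≤ degᶜ c → T'⊆Gᶜ × T*⊆Gᶜ
    co-high dcᶜ+
      with fresh _≟_ (nbᶜ c) [] (nbᶜ-unique c) (≤-trans (s≤s z≤n) dcᶜ+)
    ... | a , a∈c , []
      with fresh _≟_ (nbᶜ a) (c ∷ []) (nbᶜ-unique a) (≤-trans (s≤s (s≤s z≤n)) (co≥ a))
    ... | x , x∈a , c≢x ∷ []
      with fresh _≟_ (nbᶜ x) (c ∷ a ∷ []) (nbᶜ-unique x) (≤-trans (s≤s (s≤s (s≤s z≤n))) (co≥ x))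
    ... | y , y∈x , c≢y ∷ a≢y ∷ [] =
      T'-copy (a ∷ x ∷ []) (5 + k) a∈c x∈a c≢x (covers-itself _ _) dcᶜ+ ,
      T*-copy (a ∷ x ∷ y ∷ []) (4 + k) a∈c x∈a y∈x c≢x c≢y a≢y (covers-itself _ _) dcᶜ+

    -- A co-edge a x with a ∈ Nᶜ(c), x ∈ N(c): x need not be avoided by the
    -- co-spokes of c, so degᶜ c ≥ n − 2 suffices.
    cross-co-edge : ∀ {a x} → a ∈ nbᶜ c → x ∈ nb c → x ∈ nbᶜ a → T'⊆Gᶜ × T*⊆Gᶜ
    cross-co-edge {a} {x} a∈c x∈c x∈a
      with fresh _≟_ (nbᶜ x) (c ∷ a ∷ []) (nbᶜ-unique x) (≤-trans (s≤s (s≤s (s≤s z≤n))) (co≥ x))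
    ... | y , y∈x , c≢y ∷ a≢y ∷ [] =
      T'-copy (a ∷ []) (5 + k) a∈c x∈a (nb-irrefl x∈c) ((λ _ → here refl) ∷ x-not-co-spoke ∷ []) dcᶜ ,
      T*-copy (a ∷ y ∷ []) (4 + k) a∈c x∈a y∈x (nb-irrefl x∈c) c≢y a≢y
        ((λ _ → here refl) ∷ x-not-co-spoke ∷ (λ _ → there (here refl)) ∷ []) dcᶜ
      where
      x-not-co-spoke : ∀ {F} → x ∈ nbᶜ c → x ∈ F
      x-not-co-spoke x∈ᶜc = ⊥-elim (nb-disjoint x∈c x∈ᶜc)

    -- Otherwise degᶜ c ≤ n − 2, so c has a neighbour b; with no co-edge between
    -- N(c) and Nᶜ(c), b sees c and all of Nᶜ(c): deg b ≥ n − 1, a contradiction.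
    result : T'⊆Gᶜ × T*⊆Gᶜ
    result with 7 + k ≤? degᶜ c
    ... | yes dcᶜ+ = co-high dcᶜ+
    ... | no ¬dcᶜ+ with ∃∈? (λ a → ∃∈? (λ x → x ∈? nbᶜ a) (nb c)) (nbᶜ c)
    ...   | yes (a , a∈c , x , x∈c , x∈a) = cross-co-edge a∈c x∈c x∈a
    ...   | no ∄ with fresh _≟_ (nb c) [] (nb-unique c) (≤-trans (s≤s z≤n) (deg-≥ 6 4 refl (≤-pred (≰⇒> ¬dcᶜ+))))
    ...     | b , b∈c , [] = ⊥-elim (1+n≰n (≤-trans (s≤s dcᶜ) (≤-trans (pigeonhole _≟_ L! L⊆N[b]) (all≤ b))))
      where
      L! : Unique (c ∷ nbᶜ c)
      L! = All.tabulate nbᶜ-irrefl ∷ nbᶜ-unique c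
      L⊆N[b] : All (_∈ nb b) (c ∷ nbᶜ c)
      L⊆N[b] = nb-sym b∈c ∷ All.tabulate (λ a∈c →
        nb-sym (nb-intro (≢-sym (nb-nbᶜ-distinct b∈c a∈c)) (λ b∈a → ∄ (_ , a∈c , _ , b∈c , b∈a))))

  -- Case C: all degrees are n − 3 or n − 2, and deg c = n − 2.  A co-neighbour
  -- b of c shares a neighbour a with c; the edge a b hangs off the spoke a.
  almost-regular : (∀ v → deg v ≤ 6 + k) → (∀ v → 5 + k ≤ deg v) → ∀ c → 6 + k ≤ deg c → T1⊆G × T2⊆G
  almost-regular all≤ all≥ c dc
    with fresh _≟_ (nbᶜ c) [] (nbᶜ-unique c) (≤-trans (s≤s z≤n) (degᶜ-≥ 6 4 refl (all≤ c)))
  ... | b , b∈c , []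
    with common-neighbour b∈c (≤-trans (degᶜ-≤ 6 4 refl dc) (≤-trans (n≤1+n (4 + k)) (all≥ b)))
  ... | a , a∈b , a∈c
    with fresh _≟_ (nb a) (c ∷ b ∷ []) (nb-unique a) (≤-trans (s≤s (s≤s (s≤s z≤n))) (all≥ a))
       | fresh _≟_ (nb c) (a ∷ []) (nb-unique c) (≤-trans (s≤s (s≤s z≤n)) dc)
  ... | y , y∈a , c≢y ∷ b≢y ∷ [] | b' , b'∈c , a≢b' ∷ []
    with fresh _≟_ (nb b') (c ∷ a ∷ b ∷ []) (nb-unique b') (≤-trans (s≤s (s≤s (s≤s (s≤s z≤n)))) (all≥ b'))
  ... | y' , y'∈b' , c≢y' ∷ a≢y' ∷ b≢y' ∷ [] =
    T1-copy (a ∷ b' ∷ y' ∷ []) (3 + k) a∈c b'∈c (nb-sym a∈b) y'∈b' a≢b' c≢b c≢y' a≢y'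
      (nb-nbᶜ-distinct b'∈c b∈c) b≢y'
      ((λ _ → here refl) ∷ (λ _ → there (here refl)) ∷ b-not-spoke ∷ (λ _ → there (there (here refl))) ∷ []) dc ,
    T2-copy (a ∷ y ∷ []) (4 + k) a∈c (nb-sym a∈b) y∈a c≢b c≢y b≢y
      ((λ _ → here refl) ∷ b-not-spoke ∷ (λ _ → there (here refl)) ∷ []) dc
    where
    c≢b : c ≢ b
    c≢b = nbᶜ-irrefl b∈c
    b-not-spoke : ∀ {F} → b ∈ nb c → b ∈ F
    b-not-spoke b∈c' = ⊥-elim (nb-disjoint b∈c' b∈c)

  -- Case D: G is (n − 3)-regular, so Gᶜ is too.  Fix any vertex c; every
  -- co-neighbour b of c has a neighbour in common with c.
  module Regular (all≤ : ∀ v → deg v ≤ 5 + k) (all≥ : ∀ v → 5 + k ≤ deg v) (c : Fin N) where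

    dcᶜ≥ : 5 + k ≤ degᶜ c
    dcᶜ≥ = degᶜ-≥ 5 5 refl (all≤ c)

    joint : ∀ {b} → b ∈ nbᶜ c → ∃[ a ] a ∈ nb b × a ∈ nb c
    joint {b} b∈c = common-neighbour b∈c (≤-trans (degᶜ-≤ 5 5 refl (all≥ c)) (all≥ b))

    too-many : ∀ {v L} → Unique L → All (_∈ nb v) L → 6 + k ≤ length L → ⊥
    too-many {v} L! L⊆ 6+k≤L = 1+n≰n (≤-trans 6+k≤L (≤-trans (pigeonhole _≟_ L! L⊆) (all≤ v)))

    c-not-spoke : ∀ {b F} → b ∈ nbᶜ c → b ∈ nb c → b ∈ F
    c-not-spoke b∈ᶜc b∈c = ⊥-elim (nb-disjoint b∈c b∈ᶜc)

    -- T_n^1 at c with pendant edges a₁ b₁ and a₂ b, unless every b ∈ Nᶜ(c) sees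
    -- only a₁ inside N(c); but then N(a₁) ⊇ {c} ∪ Nᶜ(c) is too large.
    regular-T1 : ∀ {b₁ a₁} → b₁ ∈ nbᶜ c → a₁ ∈ nb b₁ → a₁ ∈ nb c → T1⊆G
    regular-T1 {b₁} {a₁} b₁∈c a₁∈b₁ a₁∈c
      with ∃∈? (λ b → ¬? (b ≟ b₁) ×-dec ∃∈? (λ a → (a ∈? nb c) ×-dec ¬? (a ≟ a₁)) (nb b)) (nbᶜ c)
    ... | yes (b , b∈c , b≢b₁ , a₂ , a₂∈b , a₂∈c , a₂≢a₁) =
      T1-copy (a₁ ∷ a₂ ∷ []) (3 + k) a₁∈c a₂∈c (nb-sym a₁∈b₁) (nb-sym a₂∈b) (≢-sym a₂≢a₁)
        (nbᶜ-irrefl b₁∈c) (nbᶜ-irrefl b∈c) (nb-nbᶜ-distinct a₁∈c b∈c) (nb-nbᶜ-distinct a₂∈c b₁∈c) (≢-sym b≢b₁)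
        ((λ _ → here refl) ∷ (λ _ → there (here refl)) ∷ c-not-spoke b₁∈c ∷ c-not-spoke b∈c ∷ []) (all≥ c)
    ... | no ∄ = ⊥-elim (too-many (All.tabulate nbᶜ-irrefl ∷ nbᶜ-unique c) (nb-sym a₁∈c ∷ All.tabulate sees-a₁) (s≤s dcᶜ≥))
      where
      sees-a₁ : ∀ {b} → b ∈ nbᶜ c → b ∈ nb a₁
      sees-a₁ {b} b∈c with b ≟ b₁ | joint b∈c
      ... | yes refl | _ = nb-sym a₁∈b₁
      ... | no b≢b₁ | a , a∈b , a∈c with a ≟ a₁
      ...   | yes refl = nb-sym a∈b
      ...   | no a≢a₁ = ⊥-elim (∄ (b , b∈c , b≢b₁ , a , a∈b , a∈c , a≢a₁))

    -- Suppose every vertex of N(c) has at most one neighbour in Nᶜ(c), and all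
    -- neighbours of a₁ except c, b₁ are neighbours of b₁.  Then n − 5 of them,
    -- with a₁, lie in N(c) ∩ N(b₁); adding private neighbours a₂, a₃ in N(c) of two
    -- further co-neighbours b₂, b₃ of c gives n − 2 neighbours of c.
    crowded : (∀ {a x y} → a ∈ nb c → x ∈ nb a → y ∈ nb a → x ∈ nbᶜ c → y ∈ nbᶜ c → x ≡ y) →
      ∀ {a₁ b₁} → a₁ ∈ nb c → a₁ ∈ nb b₁ → b₁ ∈ nbᶜ c →
      (∀ {y} → y ∈ nb a₁ → y ≢ c → y ≢ b₁ → y ∈ nb b₁) → ⊥
    crowded one {a₁} {b₁} a₁∈c a₁∈b₁ b₁∈c N[a₁]⊆N[b₁]
      with choose _≟_ (nb a₁) (c ∷ b₁ ∷ []) (3 + k) (nb-unique a₁) (all≥ a₁)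
         | fresh _≟_ (nbᶜ c) (b₁ ∷ []) (nbᶜ-unique c) (≤-trans (s≤s (s≤s z≤n)) dcᶜ≥)
    ... | Y , |Y| , Y! , Y-spec | b₂ , b₂∈c , b₁≢b₂ ∷ []
      with fresh _≟_ (nbᶜ c) (b₁ ∷ b₂ ∷ []) (nbᶜ-unique c) (≤-trans (s≤s (s≤s (s≤s z≤n))) dcᶜ≥)
    ... | b₃ , b₃∈c , b₁≢b₃ ∷ b₂≢b₃ ∷ []
      with joint b₂∈c | joint b₃∈c
    ... | a₂ , a₂∈b₂ , a₂∈c | a₃ , a₃∈b₃ , a₃∈c =
      too-many ((a₂≢a₃ ∷ outside a₂∈b₂ b₂∈c b₁≢b₂) ∷ outside a₃∈b₃ b₃∈c b₁≢b₃ ∷ S₁!)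
               (a₂∈c ∷ a₃∈c ∷ All.map proj₁ S₁⊆) (≤-reflexive (cong (3 +_) (sym |Y|)))
      where
      in-both : ∀ {y} → y ∈ nb a₁ × y ∉ c ∷ b₁ ∷ [] → y ∈ nb c × y ∈ nb b₁
      in-both {y} (y∈a₁ , y∉) =
        nb-intro (λ c≡y → y∉ (here (sym c≡y)))
                 (λ y∈ᶜc → y∉ (there (here (sym (one a₁∈c (nb-sym a₁∈b₁) y∈a₁ b₁∈c y∈ᶜc))))) ,
        N[a₁]⊆N[b₁] y∈a₁ (λ y≡c → y∉ (here y≡c)) (λ y≡b₁ → y∉ (there (here y≡b₁)))
      S₁⊆ : All (λ v → v ∈ nb c × v ∈ nb b₁) (a₁ ∷ Y)
      S₁⊆ = (a₁∈c , a₁∈b₁) ∷ All.map in-both Y-spec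
      S₁! : Unique (a₁ ∷ Y)
      S₁! = All.map (λ (y∈a₁ , _) → nb-irrefl y∈a₁) Y-spec ∷ Y!
      -- a vertex of N(c) seeing b ∈ Nᶜ(c) ∖ {b₁} cannot also see b₁
      outside : ∀ {a b} → a ∈ nb b → b ∈ nbᶜ c → b₁ ≢ b → All (a ≢_) (a₁ ∷ Y)
      outside {a} {b} a∈b b∈c b₁≢b = All.map (λ { (s∈c , s∈b₁) refl → b₁≢b (one s∈c (nb-sym s∈b₁) (nb-sym a∈b) b₁∈c b∈c) }) S₁⊆
      a₂≢a₃ : a₂ ≢ a₃
      a₂≢a₃ refl = b₂≢b₃ (one a₂∈c (nb-sym a₂∈b₂) (nb-sym a₃∈b₃) b₂∈c b₃∈c)

    -- T_n^2 at c if some a ∈ N(c) has two neighbours in Nᶜ(c); else T_n^2 at b₁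
    -- (spoke a₁, pendant edges a₁ c and a₁ y) if a₁ has a neighbour y ∉ N(b₁) ∪ {c, b₁};
    -- else the configuration is crowded.
    regular-T2 : ∀ {b₁ a₁} → b₁ ∈ nbᶜ c → a₁ ∈ nb b₁ → a₁ ∈ nb c → T2⊆G
    regular-T2 {b₁} {a₁} b₁∈c a₁∈b₁ a₁∈c
      with ∃∈? (λ a → ∃∈? (λ x → (x ∈? nbᶜ c) ×-dec ∃∈? (λ y → (y ∈? nbᶜ c) ×-dec ¬? (x ≟ y)) (nb a)) (nb a)) (nb c)
    ... | yes (a , a∈c , x , x∈a , x∈c , y , y∈a , y∈c , x≢y) =
      T2-copy (a ∷ []) (4 + k) a∈c x∈a y∈a (nbᶜ-irrefl x∈c) (nbᶜ-irrefl y∈c) x≢y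
        ((λ _ → here refl) ∷ c-not-spoke x∈c ∷ c-not-spoke y∈c ∷ []) (all≥ c)
    ... | no ∄ with ∃∈? (λ y → ¬? (y ≟ c) ×-dec ¬? (y ≟ b₁) ×-dec ¬? (y ∈? nb b₁)) (nb a₁)
    ...   | yes (y , y∈a₁ , y≢c , y≢b₁ , y∉b₁) =
      T2-copy (a₁ ∷ []) (4 + k) a₁∈b₁ (nb-sym a₁∈c) y∈a₁ (≢-sym (nbᶜ-irrefl b₁∈c)) (≢-sym y≢b₁) (≢-sym y≢c)
        ((λ _ → here refl) ∷ (λ c∈b₁ → ⊥-elim (nb-disjoint (nb-sym c∈b₁) b₁∈c)) ∷ (λ y∈b₁ → ⊥-elim (y∉b₁ y∈b₁)) ∷ [])
        (all≥ b₁)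
    ...   | no ∄' = ⊥-elim (crowded one a₁∈c a₁∈b₁ b₁∈c N[a₁]⊆N[b₁])
      where
      one : ∀ {a x y} → a ∈ nb c → x ∈ nb a → y ∈ nb a → x ∈ nbᶜ c → y ∈ nbᶜ c → x ≡ y
      one {a} {x} {y} a∈c x∈a y∈a x∈c y∈c with x ≟ y
      ... | yes x≡y = x≡y
      ... | no x≢y = ⊥-elim (∄ (a , a∈c , x , x∈a , x∈c , y , y∈a , y∈c , x≢y))
      N[a₁]⊆N[b₁] : ∀ {y} → y ∈ nb a₁ → y ≢ c → y ≢ b₁ → y ∈ nb b₁
      N[a₁]⊆N[b₁] {y} y∈a₁ y≢c y≢b₁ with y ∈? nb b₁
      ... | yes y∈b₁ = y∈b₁
      ... | no y∉b₁ = ⊥-elim (∄' (y , y∈a₁ , y≢c , y≢b₁ , y∉b₁))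

    result : T1⊆G × T2⊆G
    result with fresh _≟_ (nbᶜ c) [] (nbᶜ-unique c) (≤-trans (s≤s z≤n) dcᶜ≥)
    ... | b₁ , b₁∈c , [] with joint b₁∈c
    ... | a₁ , a₁∈b₁ , a₁∈c = regular-T1 b₁∈c a₁∈b₁ a₁∈c , regular-T2 b₁∈c a₁∈b₁ a₁∈c

  at-most : ∀ {t} → ¬ (∃[ v ] suc t ≤ deg v) → ∀ v → deg v ≤ t
  at-most ∄ v = ≤-pred (≰⇒> (λ h → ∄ (v , h)))

  at-least : ∀ {t} → ¬ (∃[ v ] deg v ≤ t) → ∀ v → suc t ≤ deg v
  at-least ∄ v = ≰⇒> (λ h → ∄ (v , h))

  select : T1⊆G × T2⊆G → ∀ i → Contains n (TiEdge i n) G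
  select (t1 , _) zero = t1
  select (_ , t2) (suc zero) = t2

  dichotomy : ∀ i → Contains n (TiEdge i n) G ⊎ (T'⊆Gᶜ × T*⊆Gᶜ)
  dichotomy i with any? (λ v → 7 + k ≤? deg v)
  ... | yes (c , dc) = high-vertex c dc i
  ... | no ∄high with any? (λ v → deg v ≤? 4 + k)
  ...   | yes (c , dc) = inj₂ (LowVertex.result (at-most ∄high) dc)
  ...   | no ∄low with any? (λ v → 6 + k ≤? deg v)
  ...     | yes (c , dc) = inj₁ (select (almost-regular (at-most ∄high) (at-least ∄low) c dc) i)
  ...     | no ∄mid = inj₁ (select (Regular.result (at-most ∄mid) (at-least ∄low) (subst Fin (sym N≡) zero)) i)

ramsey-value : ∀ k → 2 * (8 + k) ∸ 5 ≡ suc ((5 + k) + (5 + k))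
ramsey-value k = cong (3 +_) (solve 1 (λ k → k :+ ((con 8 :+ k) :+ con 0) := con 3 :+ (k :+ (con 5 :+ k))) refl k)
  where open +-*-Solver

below-ramsey-value : ∀ k {M} → M < 2 * (8 + k) ∸ 5 → M ≤ (5 + k) + (5 + k)
below-ramsey-value k {M} M<R = ≤-pred (subst (suc M ≤_) (ramsey-value k) M<R)

ramsey : ∀ k (i : Fin 2) →
    RamseyIs (8 + k) (TiEdge i (8 + k)) (8 + k) (T'Edge (8 + k)) (2 * (8 + k) ∸ 5)
  × RamseyIs (8 + k) (TiEdge i (8 + k)) (8 + k) (T*Edge (8 + k)) (2 * (8 + k) ∸ 5)
ramsey k i =
  (1≤R , (λ G → map₂ proj₁ (dichotomy G)) , (λ M _ M<R → proj₁ (lower M<R))) ,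
  (1≤R , (λ G → map₂ proj₂ (dichotomy G)) , (λ M _ M<R → proj₂ (lower M<R)))
  where
  n : ℕ
  n = 8 + k
  1≤R : 1 ≤ 2 * n ∸ 5
  1≤R = subst (1 ≤_) (sym (ramsey-value k)) (s≤s z≤n)
  dichotomy : (G : Graph (2 * n ∸ 5)) →
    Contains n (TiEdge i n) G ⊎ (Contains n (T'Edge n) (complement G) × Contains n (T*Edge n) (complement G))
  dichotomy G = UpperBound.dichotomy k G (ramsey-value k) i
  lower : ∀ {M} → M < 2 * n ∸ 5 →
    ¬ Arrows M n (TiEdge i n) n (T'Edge n) × ¬ Arrows M n (TiEdge i n) n (T*Edge n)
  lower M<R = lower-bound (5 + k) (s≤s z≤n) (below-ramsey-value k M<R) i

theorem4p2 : (n : ℕ) → 8 ≤ n → (i : Fin 2) →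
    RamseyIs n (TiEdge i n) n (T'Edge n) (2 * n ∸ 5)
      × RamseyIs n (TiEdge i n) n (T*Edge n) (2 * n ∸ 5)
theorem4p2 n 8≤n i with n ∸ 8 | m+[n∸m]≡n 8≤n
... | k | refl = ramsey k i
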